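{- Let $n$ be an odd positive integer and let $\mathrm{ord}_n(2)$ be the multiplicative order of $2$ modulo $n$. Then for every positive integer $k$ and $T=k\cdot\mathrm{ord}_n(2)$, \[ e[n]=\frac{2^{T}}{2^{T}-1}\sum_{i=0}^{T-1}\frac{2^{i}\bmod n}{2^{i}}. \]
   Context: Fix an integer $n\ge1$. The bit-efficient scheme for choosing one of $n$ options uniformly at random with a fair coin works as follows. Toss the coin repeatedly, maintaining a set of "undecided" toss sequences of the current length $t$, each having probability $2^{ -t}$. Initially ($t=0$) this set consists only of the empty sequence; if $n=1$, the procedure stops immediately with $0$ tosses. After each toss, every undecided sequence of length $t$ is replaced by its two extensions of length $t+1$. If the number of undecided sequences is now at least $n$, then $n$ of them are assigned, one to each of the $n$ options. The procedure stops and outputs the corresponding option if the observed sequence is one of these $n$; the remaining sequences stay undecided. Consequently, after $t$ tosses exactly $2^t\bmod n$ sequences are undecided. $e[n]$ denotes the expected number of tosses until this scheme stops. Here $x\bmod n$ denotes the least nonnegative residue. -}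

module Defs where

open import Data.Nat as ℕ using (ℕ; zero; suc; _∸_; _^_; _≤?_; NonZero)
open import Data.Integer using (+_)
open import Data.Rational using (ℚ; _/_; 0ℚ; _+_; _*_; _-_; ∣_∣; _<_)
open import Data.Product using (_×_; ∃-syntax)
open import Relation.Nullary using (¬_; yes; no)
open import Relation.Binary.PropositionalEquality using (_≡_; _≢_)

-- a / d as a rational number; junk value 0 when d = 0 (never used with d = 0 below)
divℕ : ℕ → ℕ → ℚ
divℕ a zero    = 0ℚ
divℕ a (suc d) = + a / suc d

sumℚ : ℕ → (ℕ → ℚ) → ℚ
sumℚ zero    f = 0ℚ
sumℚ (suc m) f = sumℚ m f + f m

-- The bit-efficient scheme for n options:
--   avail n t  = number of sequences of length t present before assigning at time t
--   undec n t  = number of undecided sequences of length t after assigning at time t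
mutual
  avail : ℕ → ℕ → ℕ
  avail n zero    = 1
  avail n (suc t) = 2 ℕ.* undec n t

  undec : ℕ → ℕ → ℕ
  undec n t with n ≤? avail n t
  ... | yes _ = avail n t ∸ n
  ... | no  _ = avail n t

stopProb : ℕ → ℕ → ℚ
stopProb n t = divℕ (avail n t ∸ undec n t) (2 ^ t)

partialExp : ℕ → ℕ → ℚ
partialExp n m = sumℚ m (λ t → divℕ t 1 * stopProb n t)

ConvergesTo : (ℕ → ℚ) → ℚ → Set
ConvergesTo a q = ∀ (ε : ℚ) → 0ℚ < ε → ∃[ N ] ∀ m → N ℕ.≤ m → ∣ a m - q ∣ < ε

-- e[n] = q : the expected number of tosses of the scheme equals q
ExpectedTosses : ℕ → ℚ → Set
ExpectedTosses n q = ConvergesTo (partialExp n) q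

IsOrderOf2 : (n : ℕ) → .{{NonZero n}} → ℕ → Set
IsOrderOf2 n d = (0 ℕ.< d) × (2 ^ d ℕ.% n ≡ 1 ℕ.% n)
               × (∀ d′ → 0 ℕ.< d′ → d′ ℕ.< d → 2 ^ d′ ℕ.% n ≢ 1 ℕ.% n)

{-# OPTIONS --safe #-}
-- After t tosses exactly rₜ = 2ᵗ mod n sequences are undecided, so the scheme is still running
-- after t tosses with probability uₜ = rₜ/2ᵗ and stops at toss t+1 with probability uₜ − uₜ₊₁.
-- Abel summation turns the truncated expectation Σ_{t≤m} t·P(stop at t) into Σ_{t<m} uₜ − m·uₘ.
-- If 2ᵀ ≡ 1 (mod n) then r is T-periodic, and summing period by period gives the exact identity
-- Σ_{t≥m} uₜ = 2⁻ᵐ/(1 − 2⁻ᵀ) · Σ_{i<T} r_{m+i}/2ⁱ, proved as a finite identity by induction on m.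
-- Both m·uₘ and this tail are O(m/2ᵐ), so the truncated expectations converge to
-- 1/(1 − 2⁻ᵀ) · Σ_{i<T} rᵢ/2ⁱ.
module Submission where

open import Defs

module _ where
  open import Data.Nat
  open import Data.Nat.Properties
  open import Data.Nat.DivMod
  open import Data.Nat.Solver using (module +-*-Solver)
  open import Relation.Binary.PropositionalEquality
  open import Relation.Nullary using (yes; no)
  open +-*-Solver

  undec≤avail : ∀ n t → undec n t ≤ avail n t
  undec≤avail n t with n ≤? avail n t
  ... | yes _ = m∸n≤m (avail n t) n
  ... | no  _ = ≤-refl

  module _ (n : ℕ) .{{_ : NonZero n}} where

    [a*b]%n≡[a*[b%n]]%n : ∀ a b → (a * b) % n ≡ (a * (b % n)) % n
    [a*b]%n≡[a*[b%n]]%n a b = begin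
      (a * b) % n                   ≡⟨ %-distribˡ-* a b n ⟩
      ((a % n) * (b % n)) % n       ≡⟨ cong (λ c → ((a % n) * c) % n) (m%n%n≡m%n b n) ⟨
      ((a % n) * (b % n % n)) % n   ≡⟨ %-distribˡ-* a (b % n) n ⟨
      (a * (b % n)) % n             ∎
      where open ≡-Reasoning

    undec≡avail%n : ∀ t → avail n t < n + n → undec n t ≡ avail n t % n
    undec≡avail%n t a<2n with n ≤? avail n t
    ... | yes n≤a = sym (begin
      avail n t % n         ≡⟨ m≤n⇒[n∸m]%m≡n%m n≤a ⟨
      (avail n t ∸ n) % n   ≡⟨ m<n⇒m%n≡m a∸n<n ⟩
      avail n t ∸ n         ∎)
      where
      open ≡-Reasoning
      a∸n<n : avail n t ∸ n < n
      a∸n<n = subst (avail n t ∸ n <_) (m+n∸n≡m n n) (∸-monoˡ-< a<2n n≤a)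
    ... | no  n≰a = sym (m<n⇒m%n≡m (≰⇒> n≰a))

    undec<n : ∀ t → undec n t < n
    undec≡2^%n : ∀ t → undec n t ≡ 2 ^ t % n

    undec≡2^%n zero = undec≡avail%n 0 (+-mono-≤ (>-nonZero⁻¹ n) (>-nonZero⁻¹ n))
    undec≡2^%n (suc t) = begin
      undec n (suc t)       ≡⟨ undec≡avail%n (suc t) 2r<2n ⟩
      (2 * undec n t) % n   ≡⟨ cong (λ r → (2 * r) % n) (undec≡2^%n t) ⟩
      (2 * (2 ^ t % n)) % n ≡⟨ [a*b]%n≡[a*[b%n]]%n 2 (2 ^ t) ⟨
      2 ^ suc t % n         ∎
      where
      open ≡-Reasoning
      2r<2n : 2 * undec n t < n + n
      2r<2n = subst (2 * undec n t <_) (cong (n +_) (+-identityʳ n)) (*-monoʳ-< 2 (undec<n t))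

    undec<n t = subst (_< n) (sym (undec≡2^%n t)) (m%n<n (2 ^ t) n)

    2^[t+T]%n≡2^t%n : ∀ {T} → 2 ^ T % n ≡ 1 % n → ∀ t → 2 ^ (t + T) % n ≡ 2 ^ t % n
    2^[t+T]%n≡2^t%n {T} 2^T≡1 t = begin
      2 ^ (t + T) % n           ≡⟨ cong (_% n) (^-distribˡ-+-* 2 t T) ⟩
      (2 ^ t * 2 ^ T) % n       ≡⟨ [a*b]%n≡[a*[b%n]]%n (2 ^ t) (2 ^ T) ⟩
      (2 ^ t * (2 ^ T % n)) % n ≡⟨ cong (λ r → (2 ^ t * r) % n) 2^T≡1 ⟩
      (2 ^ t * (1 % n)) % n     ≡⟨ [a*b]%n≡[a*[b%n]]%n (2 ^ t) 1 ⟨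
      (2 ^ t * 1) % n           ≡⟨ cong (_% n) (*-identityʳ (2 ^ t)) ⟩
      2 ^ t % n                 ∎
      where open ≡-Reasoning

    2^[k*d]%n≡1 : ∀ {d} → 2 ^ d % n ≡ 1 % n → ∀ k → 2 ^ (k * d) % n ≡ 1 % n
    2^[k*d]%n≡1 2^d≡1 zero = refl
    2^[k*d]%n≡1 {d} 2^d≡1 (suc k) = begin
      2 ^ (d + k * d) % n ≡⟨ cong (λ e → 2 ^ e % n) (+-comm d (k * d)) ⟩
      2 ^ (k * d + d) % n ≡⟨ 2^[t+T]%n≡2^t%n 2^d≡1 (k * d) ⟩
      2 ^ (k * d) % n     ≡⟨ 2^[k*d]%n≡1 2^d≡1 k ⟩
      1 % n               ∎
      where open ≡-Reasoning

    undec-periodic : ∀ {T} → 2 ^ T % n ≡ 1 % n → ∀ t → undec n (t + T) ≡ undec n t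
    undec-periodic {T} 2^T≡1 t = begin
      undec n (t + T)   ≡⟨ undec≡2^%n (t + T) ⟩
      2 ^ (t + T) % n   ≡⟨ 2^[t+T]%n≡2^t%n 2^T≡1 t ⟩
      2 ^ t % n         ≡⟨ undec≡2^%n t ⟨
      undec n t         ∎
      where open ≡-Reasoning

  n*n≤2^n : ∀ {n} → 4 ≤′ n → n * n ≤ 2 ^ n
  n*n≤2^n ≤′-refl = ≤-refl
  n*n≤2^n (≤′-step {n} 4≤′n) = begin
    suc n * suc n         ≡⟨ square-suc n ⟩
    n * n + (n + (n + 1)) ≤⟨ +-monoʳ-≤ (n * n) 2n+1≤n*n ⟩
    n * n + n * n         ≤⟨ +-mono-≤ (n*n≤2^n 4≤′n) (n*n≤2^n 4≤′n) ⟩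
    2 ^ n + 2 ^ n         ≡⟨ cong (2 ^ n +_) (+-identityʳ (2 ^ n)) ⟨
    2 ^ suc n             ∎
    where
    open ≤-Reasoning
    square-suc : ∀ n → suc n * suc n ≡ n * n + (n + (n + 1))
    square-suc = solve 1 (λ n → (con 1 :+ n) :* (con 1 :+ n) := n :* n :+ (n :+ (n :+ con 1))) refl
    2n+1≤n*n : n + (n + 1) ≤ n * n
    2n+1≤n*n = begin
      n + (n + 1)   ≤⟨ +-monoʳ-≤ n (+-monoʳ-≤ n (≤-trans (s≤s z≤n) (≤′⇒≤ 4≤′n))) ⟩
      n + (n + n)   ≡⟨ cong (λ m → n + (n + m)) (+-identityʳ n) ⟨
      3 * n         ≤⟨ *-monoˡ-≤ n (≤-trans (n≤1+n 3) (≤′⇒≤ 4≤′n)) ⟩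
      n * n         ∎

  m*C<2^m : ∀ {C m} → 4 + C ≤ m → m * C < 2 ^ m
  m*C<2^m {C} {m} 4+C≤m = begin-strict
    m * C  <⟨ *-monoʳ-< m (≤-trans (m≤n+m (suc C) 3) 4+C≤m) ⟩
    m * m  ≤⟨ n*n≤2^n (≤⇒≤′ (≤-trans (m≤m+n 4 C) 4+C≤m)) ⟩
    2 ^ m  ∎
    where
    open ≤-Reasoning
    instance
      _ : NonZero m
      _ = >-nonZero (≤-trans (s≤s z≤n) 4+C≤m)

module _ where
  open import Data.Nat as ℕ using (ℕ; zero; suc; _^_)
  import Data.Nat.Properties as ℕ
  open import Data.Integer as ℤ using (+_)
  import Data.Integer.Properties as ℤ
  open import Data.Rational using (ℚ; 0ℚ; 1ℚ; mkℚ; toℚᵘ; _+_; _*_; _-_; -_; ∣_∣; _≤_; _<_; Positive; positive; nonNegative)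
  import Data.Rational.Properties as ℚ
  open import Data.Rational.Solver using (module +-*-Solver)
  open import Data.Rational.Unnormalised as ℚᵘ using (mkℚᵘ; _≃_; *≡*; *≤*; *<*)
  import Data.Rational.Unnormalised.Properties as ℚᵘ
  open import Data.Product using (∃₂; _,_)
  open import Relation.Binary.PropositionalEquality
  open +-*-Solver

  fromℕ : ℕ → ℚ
  fromℕ a = divℕ a 1

  toℚᵘ-divℕ : ∀ a d → toℚᵘ (divℕ a (suc d)) ≃ mkℚᵘ (+ a) d
  toℚᵘ-divℕ a d = ℚ.toℚᵘ-fromℚᵘ (mkℚᵘ (+ a) d)

  fromℕ-+ : ∀ a b → fromℕ (a ℕ.+ b) ≡ fromℕ a + fromℕ b
  fromℕ-+ a b = ℚ.toℚᵘ-injective (begin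
    toℚᵘ (fromℕ (a ℕ.+ b))             ≈⟨ toℚᵘ-divℕ (a ℕ.+ b) 0 ⟩
    mkℚᵘ (+ (a ℕ.+ b)) 0                ≈⟨ *≡* (cong (ℤ._* + 1) (cong₂ ℤ._+_ (sym (ℤ.*-identityʳ (+ a))) (sym (ℤ.*-identityʳ (+ b))))) ⟩
    mkℚᵘ (+ a) 0 ℚᵘ.+ mkℚᵘ (+ b) 0     ≈⟨ ℚᵘ.+-cong (toℚᵘ-divℕ a 0) (toℚᵘ-divℕ b 0) ⟨
    toℚᵘ (fromℕ a) ℚᵘ.+ toℚᵘ (fromℕ b) ≈⟨ ℚ.toℚᵘ-homo-+ (fromℕ a) (fromℕ b) ⟨
    toℚᵘ (fromℕ a + fromℕ b)            ∎)
    where open ℚᵘ.≃-Reasoning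

  fromℕ-* : ∀ a b → fromℕ (a ℕ.* b) ≡ fromℕ a * fromℕ b
  fromℕ-* a b = ℚ.toℚᵘ-injective (begin
    toℚᵘ (fromℕ (a ℕ.* b))             ≈⟨ toℚᵘ-divℕ (a ℕ.* b) 0 ⟩
    mkℚᵘ (+ (a ℕ.* b)) 0                ≈⟨ *≡* (cong (ℤ._* + 1) (ℤ.pos-* a b)) ⟩
    mkℚᵘ (+ a) 0 ℚᵘ.* mkℚᵘ (+ b) 0     ≈⟨ ℚᵘ.*-cong (toℚᵘ-divℕ a 0) (toℚᵘ-divℕ b 0) ⟨
    toℚᵘ (fromℕ a) ℚᵘ.* toℚᵘ (fromℕ b) ≈⟨ ℚ.toℚᵘ-homo-* (fromℕ a) (fromℕ b) ⟨
    toℚᵘ (fromℕ a * fromℕ b)            ∎)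
    where open ℚᵘ.≃-Reasoning

  fromℕ-∸ : ∀ {a b} → b ℕ.≤ a → fromℕ (a ℕ.∸ b) ≡ fromℕ a - fromℕ b
  fromℕ-∸ {a} {b} b≤a = begin
    fromℕ (a ℕ.∸ b)                       ≡⟨ solve 2 (λ x y → x := (x :+ y) :- y) refl (fromℕ (a ℕ.∸ b)) (fromℕ b) ⟩
    (fromℕ (a ℕ.∸ b) + fromℕ b) - fromℕ b ≡⟨ cong (_- fromℕ b) (fromℕ-+ (a ℕ.∸ b) b) ⟨
    fromℕ (a ℕ.∸ b ℕ.+ b) - fromℕ b       ≡⟨ cong (λ c → fromℕ c - fromℕ b) (ℕ.m∸n+n≡m b≤a) ⟩
    fromℕ a - fromℕ b                     ∎
    where open ≡-Reasoning

  fromℕ-mono-≤ : ∀ {a b} → a ℕ.≤ b → fromℕ a ≤ fromℕ b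
  fromℕ-mono-≤ {a} {b} a≤b = ℚ.toℚᵘ-cancel-≤ (ℚᵘ.≤-respˡ-≃ (ℚᵘ.≃-sym (toℚᵘ-divℕ a 0))
    (ℚᵘ.≤-respʳ-≃ (ℚᵘ.≃-sym (toℚᵘ-divℕ b 0)) (*≤* (ℤ.*-monoʳ-≤-nonNeg (+ 1) (ℤ.+≤+ a≤b)))))

  fromℕ-mono-< : ∀ {a b} → a ℕ.< b → fromℕ a < fromℕ b
  fromℕ-mono-< {a} {b} a<b = ℚ.toℚᵘ-cancel-< (ℚᵘ.<-respˡ-≃ (ℚᵘ.≃-sym (toℚᵘ-divℕ a 0))
    (ℚᵘ.<-respʳ-≃ (ℚᵘ.≃-sym (toℚᵘ-divℕ b 0)) (*<* (ℤ.*-monoʳ-<-pos (+ 1) (ℤ.+<+ a<b)))))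

  divℕ-nonNeg : ∀ a b → 0ℚ ≤ divℕ a b
  divℕ-nonNeg a zero    = ℚ.≤-refl
  divℕ-nonNeg a (suc d) = ℚ.toℚᵘ-cancel-≤ (ℚᵘ.≤-respʳ-≃ (ℚᵘ.≃-sym (toℚᵘ-divℕ a d))
    (*≤* (subst (ℤ._≤_ (+ 0)) (sym (ℤ.*-identityʳ (+ a))) (ℤ.+≤+ ℕ.z≤n))))

  fromℕ-nonNeg : ∀ a → 0ℚ ≤ fromℕ a
  fromℕ-nonNeg a = divℕ-nonNeg a 1

  *-nonNeg : ∀ {p q} → 0ℚ ≤ p → 0ℚ ≤ q → 0ℚ ≤ p * q
  *-nonNeg {p} {q} 0≤p 0≤q = ℚ.nonNegative⁻¹ (p * q)
    {{ℚ.nonNeg*nonNeg⇒nonNeg p {{nonNegative 0≤p}} q {{nonNegative 0≤q}}}}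

  *-denominator≡numerator : ∀ q a d → toℚᵘ q ≃ mkℚᵘ (+ a) d → q * fromℕ (suc d) ≡ fromℕ a
  *-denominator≡numerator q a d q≃a/d = ℚ.toℚᵘ-injective (begin
    toℚᵘ (q * fromℕ (suc d))               ≈⟨ ℚ.toℚᵘ-homo-* q (fromℕ (suc d)) ⟩
    toℚᵘ q ℚᵘ.* toℚᵘ (fromℕ (suc d))       ≈⟨ ℚᵘ.*-cong q≃a/d (toℚᵘ-divℕ (suc d) 0) ⟩
    mkℚᵘ (+ a) d ℚᵘ.* mkℚᵘ (+ suc d) 0     ≈⟨ *≡* (subst (λ e → (+ a ℤ.* + suc d) ℤ.* + 1 ≡ + a ℤ.* + suc e)
                                                (sym (ℕ.*-identityʳ d)) (ℤ.*-identityʳ _)) ⟩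
    mkℚᵘ (+ a) 0                           ≈⟨ toℚᵘ-divℕ a 0 ⟨
    toℚᵘ (fromℕ a)                         ∎)
    where open ℚᵘ.≃-Reasoning

  divℕ-*-fromℕ : ∀ a {b} → 0 ℕ.< b → divℕ a b * fromℕ b ≡ fromℕ a
  divℕ-*-fromℕ a {suc d} _ = *-denominator≡numerator (divℕ a (suc d)) a d (toℚᵘ-divℕ a d)

  *-cancelʳ-fromℕ : ∀ {p q} b → 0 ℕ.< b → p * fromℕ b ≡ q * fromℕ b → p ≡ q
  *-cancelʳ-fromℕ b 0<b pb≡qb = ℚ.≤-antisym
    (ℚ.*-cancelʳ-≤-pos (fromℕ b) {{b⁺}} (ℚ.≤-reflexive pb≡qb))
    (ℚ.*-cancelʳ-≤-pos (fromℕ b) {{b⁺}} (ℚ.≤-reflexive (sym pb≡qb)))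
    where
    b⁺ : Positive (fromℕ b)
    b⁺ = positive (fromℕ-mono-< 0<b)

  divℕ≡fromℕ*divℕ1 : ∀ a {b} → 0 ℕ.< b → divℕ a b ≡ fromℕ a * divℕ 1 b
  divℕ≡fromℕ*divℕ1 a {b} 0<b = *-cancelʳ-fromℕ b 0<b (begin
    divℕ a b * fromℕ b                ≡⟨ divℕ-*-fromℕ a 0<b ⟩
    fromℕ a                           ≡⟨ ℚ.*-identityʳ (fromℕ a) ⟨
    fromℕ a * 1ℚ                      ≡⟨ cong (fromℕ a *_) (divℕ-*-fromℕ 1 0<b) ⟨
    fromℕ a * (divℕ 1 b * fromℕ b)    ≡⟨ ℚ.*-assoc (fromℕ a) (divℕ 1 b) (fromℕ b) ⟨
    fromℕ a * divℕ 1 b * fromℕ b      ∎)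
    where open ≡-Reasoning

  positive⇒fraction : ∀ ε → 0ℚ < ε → ∃₂ λ d a → ε * fromℕ (suc d) ≡ fromℕ (suc a)
  positive⇒fraction ε 0<ε = fraction ε {{positive 0<ε}}
    where
    fraction : ∀ ε → .{{Positive ε}} → ∃₂ λ d a → ε * fromℕ (suc d) ≡ fromℕ (suc a)
    fraction ε@(mkℚ (+ suc a) d _) = d , a , *-denominator≡numerator ε (suc a) d ℚᵘ.≃-refl

  ½^ : ℕ → ℚ
  ½^ t = divℕ 1 (2 ^ t)

  ½^-nonNeg : ∀ t → 0ℚ ≤ ½^ t
  ½^-nonNeg t = divℕ-nonNeg 1 (2 ^ t)

  ½^-*-2^ : ∀ t → ½^ t * fromℕ (2 ^ t) ≡ 1ℚ
  ½^-*-2^ t = divℕ-*-fromℕ 1 (ℕ.m^n>0 2 t)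

  ½^-suc : ∀ t → ½^ (suc t) * fromℕ 2 ≡ ½^ t
  ½^-suc t = *-cancelʳ-fromℕ (2 ^ t) (ℕ.m^n>0 2 t) (begin
    ½^ (suc t) * fromℕ 2 * fromℕ (2 ^ t)   ≡⟨ ℚ.*-assoc (½^ (suc t)) (fromℕ 2) (fromℕ (2 ^ t)) ⟩
    ½^ (suc t) * (fromℕ 2 * fromℕ (2 ^ t)) ≡⟨ cong (½^ (suc t) *_) (fromℕ-* 2 (2 ^ t)) ⟨
    ½^ (suc t) * fromℕ (2 ^ suc t)         ≡⟨ ½^-*-2^ (suc t) ⟩
    1ℚ                                     ≡⟨ ½^-*-2^ t ⟨
    ½^ t * fromℕ (2 ^ t)                   ∎)
    where open ≡-Reasoning

  ½^≤1 : ∀ t → ½^ t ≤ 1ℚ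
  ½^≤1 t = ℚ.*-cancelʳ-≤-pos (fromℕ (2 ^ t)) {{positive (fromℕ-mono-< (ℕ.m^n>0 2 t))}} (begin
    ½^ t * fromℕ (2 ^ t) ≡⟨ ½^-*-2^ t ⟩
    fromℕ 1              ≤⟨ fromℕ-mono-≤ (ℕ.m^n>0 2 t) ⟩
    fromℕ (2 ^ t)        ≡⟨ ℚ.*-identityˡ (fromℕ (2 ^ t)) ⟨
    1ℚ * fromℕ (2 ^ t)   ∎)
    where open ℚ.≤-Reasoning

  sumℚ-cong : ∀ m {f g : ℕ → ℚ} → (∀ i → f i ≡ g i) → sumℚ m f ≡ sumℚ m g
  sumℚ-cong zero    f≡g = refl
  sumℚ-cong (suc m) f≡g = cong₂ _+_ (sumℚ-cong m f≡g) (f≡g m)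

  sumℚ-suc : ∀ m f → sumℚ (suc m) f ≡ f 0 + sumℚ m (λ i → f (suc i))
  sumℚ-suc zero    f = ℚ.+-comm 0ℚ (f 0)
  sumℚ-suc (suc m) f = begin
    sumℚ (suc m) f + f (suc m)                     ≡⟨ cong (_+ f (suc m)) (sumℚ-suc m f) ⟩
    f 0 + sumℚ m (λ i → f (suc i)) + f (suc m)     ≡⟨ ℚ.+-assoc (f 0) _ _ ⟩
    f 0 + sumℚ (suc m) (λ i → f (suc i))           ∎
    where open ≡-Reasoning

  sumℚ-*ʳ : ∀ m f c → sumℚ m f * c ≡ sumℚ m (λ i → f i * c)
  sumℚ-*ʳ zero    f c = ℚ.*-zeroˡ c
  sumℚ-*ʳ (suc m) f c = trans (ℚ.*-distribʳ-+ c (sumℚ m f) (f m)) (cong (_+ f m * c) (sumℚ-*ʳ m f c))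

  sumℚ-nonNeg : ∀ m {f} → (∀ i → 0ℚ ≤ f i) → 0ℚ ≤ sumℚ m f
  sumℚ-nonNeg zero    0≤f = ℚ.≤-refl
  sumℚ-nonNeg (suc m) 0≤f = ℚ.+-mono-≤ (sumℚ-nonNeg m 0≤f) (0≤f m)

  sumℚ-≤ : ∀ m {f b} → (∀ i → f i ≤ b) → sumℚ m f ≤ fromℕ m * b
  sumℚ-≤ zero    {b = b} f≤b = ℚ.≤-reflexive (sym (ℚ.*-zeroˡ b))
  sumℚ-≤ (suc m) {b = b} f≤b = ℚ.≤-trans (ℚ.+-mono-≤ (sumℚ-≤ m f≤b) (f≤b m)) (ℚ.≤-reflexive (begin
    fromℕ m * b + b    ≡⟨ solve 2 (λ x y → x :* y :+ y := (con 1ℚ :+ x) :* y) refl (fromℕ m) b ⟩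
    (1ℚ + fromℕ m) * b ≡⟨ cong (_* b) (fromℕ-+ 1 m) ⟨
    fromℕ (suc m) * b  ∎))
    where open ≡-Reasoning

  abel-summation : ∀ (p u : ℕ → ℚ) → (∀ t → p (suc t) ≡ u t - u (suc t)) →
                   ∀ m → sumℚ (suc m) (λ t → fromℕ t * p t) ≡ sumℚ m u - fromℕ m * u m
  abel-summation p u p≡Δu zero = solve 2 (λ p0 u0 → con 0ℚ :+ con 0ℚ :* p0 := con 0ℚ :- con 0ℚ :* u0) refl (p 0) (u 0)
  abel-summation p u p≡Δu (suc m) = begin
    sumℚ (suc m) (λ t → fromℕ t * p t) + fromℕ (suc m) * p (suc m)
      ≡⟨ cong₂ _+_ (abel-summation p u p≡Δu m) (cong₂ _*_ (fromℕ-+ 1 m) (p≡Δu m)) ⟩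
    (sumℚ m u - fromℕ m * u m) + (1ℚ + fromℕ m) * (u m - u (suc m))
      ≡⟨ solve 4 (λ U i a b → (U :- i :* a) :+ (con 1ℚ :+ i) :* (a :- b) := (U :+ a) :- (con 1ℚ :+ i) :* b)
           refl (sumℚ m u) (fromℕ m) (u m) (u (suc m)) ⟩
    (sumℚ m u + u m) - (1ℚ + fromℕ m) * u (suc m)
      ≡⟨ cong (λ i → (sumℚ m u + u m) - i * u (suc m)) (fromℕ-+ 1 m) ⟨
    sumℚ (suc m) u - fromℕ (suc m) * u (suc m)
      ∎
    where open ≡-Reasoning

  periodFactor : ℕ → ℚ
  periodFactor T = divℕ (2 ^ T) (2 ^ T ℕ.∸ 1)

  module _ {T : ℕ} (0<T : 0 ℕ.< T) where

    private
      0<2^T∸1 : 0 ℕ.< 2 ^ T ℕ.∸ 1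
      0<2^T∸1 = ℕ.m<n⇒0<n∸m (ℕ.^-monoʳ-< 2 (ℕ.s≤s (ℕ.s≤s ℕ.z≤n)) 0<T)

      2^T≡1+[2^T∸1] : fromℕ (2 ^ T) ≡ 1ℚ + fromℕ (2 ^ T ℕ.∸ 1)
      2^T≡1+[2^T∸1] = trans (cong fromℕ (sym (ℕ.m+[n∸m]≡n (ℕ.m^n>0 2 T)))) (fromℕ-+ 1 (2 ^ T ℕ.∸ 1))

    periodFactor-*-[1-½^]≡1 : periodFactor T * (1ℚ - ½^ T) ≡ 1ℚ
    periodFactor-*-[1-½^]≡1 = *-cancelʳ-fromℕ (2 ^ T) (ℕ.m^n>0 2 T) (begin
      c * (1ℚ - ½^ T) * fromℕ (2 ^ T)
        ≡⟨ solve 3 (λ c h p → c :* (con 1ℚ :- h) :* p := c :* p :- c :* (h :* p)) refl c (½^ T) (fromℕ (2 ^ T)) ⟩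
      c * fromℕ (2 ^ T) - c * (½^ T * fromℕ (2 ^ T))
        ≡⟨ cong₂ (λ p h → c * p - c * h) 2^T≡1+[2^T∸1] (½^-*-2^ T) ⟩
      c * (1ℚ + D) - c * 1ℚ
        ≡⟨ solve 2 (λ c d → c :* (con 1ℚ :+ d) :- c :* con 1ℚ := c :* d) refl c D ⟩
      c * D
        ≡⟨ divℕ-*-fromℕ (2 ^ T) 0<2^T∸1 ⟩
      fromℕ (2 ^ T)
        ≡⟨ ℚ.*-identityˡ (fromℕ (2 ^ T)) ⟨
      1ℚ * fromℕ (2 ^ T)
        ∎)
      where
      open ≡-Reasoning
      c = periodFactor T
      D = fromℕ (2 ^ T ℕ.∸ 1)

    periodFactor≤2 : periodFactor T ≤ fromℕ 2
    periodFactor≤2 = ℚ.*-cancelʳ-≤-pos D {{positive (fromℕ-mono-< 0<2^T∸1)}} (begin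
      periodFactor T * D               ≡⟨ divℕ-*-fromℕ (2 ^ T) 0<2^T∸1 ⟩
      fromℕ (2 ^ T)                    ≤⟨ fromℕ-mono-≤ 2^T≤2*[2^T∸1] ⟩
      fromℕ (2 ℕ.* (2 ^ T ℕ.∸ 1))      ≡⟨ fromℕ-* 2 (2 ^ T ℕ.∸ 1) ⟩
      fromℕ 2 * D                      ∎)
      where
      open ℚ.≤-Reasoning
      D = fromℕ (2 ^ T ℕ.∸ 1)
      2^T≤2*[2^T∸1] : 2 ^ T ℕ.≤ 2 ℕ.* (2 ^ T ℕ.∸ 1)
      2^T≤2*[2^T∸1] = subst₂ ℕ._≤_ (ℕ.m+[n∸m]≡n (ℕ.m^n>0 2 T)) (cong (2 ^ T ℕ.∸ 1 ℕ.+_) (sym (ℕ.+-identityʳ _)))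
                        (ℕ.+-monoˡ-≤ (2 ^ T ℕ.∸ 1) 0<2^T∸1)

  module PeriodicSeries (x : ℕ → ℚ) {T : ℕ} (0<T : 0 ℕ.< T) (x-periodic : ∀ t → x (t ℕ.+ T) ≡ x t) where

    term : ℕ → ℚ
    term t = x t * ½^ t

    window : ℕ → ℚ
    window m = sumℚ T (λ i → x (m ℕ.+ i) * ½^ i)

    -- Σ_{t ≥ m} term t
    tail : ℕ → ℚ
    tail m = periodFactor T * window m * ½^ m

    window-suc : ∀ m → window (suc m) ≡ (window m + x m * ½^ T - x m) * fromℕ 2
    window-suc m = begin
      window (suc m)                  ≡⟨ sumℚ-cong T (λ i → sym (shifted-term i)) ⟩
      sumℚ T (λ i → f (suc i) * fromℕ 2) ≡⟨ sumℚ-*ʳ T (λ i → f (suc i)) (fromℕ 2) ⟨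
      rest * fromℕ 2                  ≡⟨ cong (_* fromℕ 2) rest≡ ⟩
      (window m + x m * ½^ T - x m) * fromℕ 2 ∎
      where
      open ≡-Reasoning
      f : ℕ → ℚ
      f i = x (m ℕ.+ i) * ½^ i
      rest = sumℚ T (λ i → f (suc i))
      shifted-term : ∀ i → f (suc i) * fromℕ 2 ≡ x (suc m ℕ.+ i) * ½^ i
      shifted-term i = begin
        x (m ℕ.+ suc i) * ½^ (suc i) * fromℕ 2   ≡⟨ ℚ.*-assoc (x (m ℕ.+ suc i)) (½^ (suc i)) (fromℕ 2) ⟩
        x (m ℕ.+ suc i) * (½^ (suc i) * fromℕ 2) ≡⟨ cong₂ _*_ (cong x (ℕ.+-suc m i)) (½^-suc i) ⟩
        x (suc m ℕ.+ i) * ½^ i                   ∎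
      rest≡ : rest ≡ window m + x m * ½^ T - x m
      rest≡ = begin
        rest                                ≡⟨ solve 2 (λ r y → r := (y :* con 1ℚ :+ r) :- y) refl rest (x m) ⟩
        (x m * 1ℚ + rest) - x m             ≡⟨ cong (λ y → (y * 1ℚ + rest) - x m) (cong x (ℕ.+-identityʳ m)) ⟨
        (f 0 + rest) - x m                  ≡⟨ cong (_- x m) (sumℚ-suc T f) ⟨
        sumℚ (suc T) f - x m                ≡⟨ cong (λ y → window m + y * ½^ T - x m) (x-periodic m) ⟩
        window m + x m * ½^ T - x m         ∎

    sumℚ+tail : ∀ m → sumℚ m term + tail m ≡ periodFactor T * window 0
    sumℚ+tail zero = solve 2 (λ c w → con 0ℚ :+ c :* w :* con 1ℚ := c :* w) refl (periodFactor T) (window 0)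
    sumℚ+tail (suc m) = trans (begin
      U + y * ½^ m + c * window (suc m) * ½^ (suc m)
        ≡⟨ cong (λ w → U + y * ½^ m + c * w * ½^ (suc m)) (window-suc m) ⟩
      U + y * ½^ m + c * ((W + y * ½^ T - y) * fromℕ 2) * ½^ (suc m)
        ≡⟨ solve 8 (λ U y h c W hT two h' →
             U :+ y :* h :+ c :* ((W :+ y :* hT :- y) :* two) :* h'
               := U :+ c :* W :* (h' :* two) :+ y :* h :- y :* (h' :* two) :* (c :* (con 1ℚ :- hT)))
             refl U y (½^ m) c W (½^ T) (fromℕ 2) (½^ (suc m)) ⟩
      U + c * W * (½^ (suc m) * fromℕ 2) + y * ½^ m - y * (½^ (suc m) * fromℕ 2) * (c * (1ℚ - ½^ T))
        ≡⟨ cong₂ (λ h a → U + c * W * h + y * ½^ m - y * h * a) (½^-suc m) (periodFactor-*-[1-½^]≡1 0<T) ⟩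
      U + c * W * ½^ m + y * ½^ m - y * ½^ m * 1ℚ
        ≡⟨ solve 4 (λ U t y h → U :+ t :+ y :* h :- y :* h :* con 1ℚ := U :+ t) refl U (c * W * ½^ m) y (½^ m) ⟩
      U + tail m
        ∎) (sumℚ+tail m)
      where
      open ≡-Reasoning
      U = sumℚ m term
      y = x m
      c = periodFactor T
      W = window m

    module _ {b : ℕ} (0≤x : ∀ t → 0ℚ ≤ x t) (x≤b : ∀ t → x t ≤ fromℕ b) where

      private
        error : ℕ → ℚ
        error m = (fromℕ m * x m + periodFactor T * window m) * ½^ m

        window-nonNeg : ∀ m → 0ℚ ≤ window m
        window-nonNeg m = sumℚ-nonNeg T (λ i → *-nonNeg (0≤x (m ℕ.+ i)) (½^-nonNeg i))

        error-nonNeg : ∀ m → 0ℚ ≤ error m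
        error-nonNeg m = *-nonNeg
          (ℚ.+-mono-≤ (*-nonNeg (fromℕ-nonNeg m) (0≤x m))
                      (*-nonNeg (divℕ-nonNeg (2 ^ T) (2 ^ T ℕ.∸ 1)) (window-nonNeg m)))
          (½^-nonNeg m)

        window≤ : ∀ m → window m ≤ fromℕ T * fromℕ b
        window≤ m = sumℚ-≤ T (λ i → begin
          x (m ℕ.+ i) * ½^ i ≤⟨ ℚ.*-monoˡ-≤-nonNeg (x (m ℕ.+ i)) {{nonNegative (0≤x (m ℕ.+ i))}} (½^≤1 i) ⟩
          x (m ℕ.+ i) * 1ℚ   ≡⟨ ℚ.*-identityʳ (x (m ℕ.+ i)) ⟩
          x (m ℕ.+ i)        ≤⟨ x≤b (m ℕ.+ i) ⟩
          fromℕ b            ∎)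
          where open ℚ.≤-Reasoning

      abel-error-≤ : ∀ m → ∣ (sumℚ m term - fromℕ m * term m) - periodFactor T * window 0 ∣
                             ≤ fromℕ (m ℕ.* b ℕ.+ 2 ℕ.* (T ℕ.* b)) * ½^ m
      abel-error-≤ m = begin
        ∣ (U - fromℕ m * term m) - periodFactor T * window 0 ∣
          ≡⟨ cong (λ s → ∣ (U - fromℕ m * term m) - s ∣) (sumℚ+tail m) ⟨
        ∣ (U - fromℕ m * term m) - (U + tail m) ∣
          ≡⟨ cong ∣_∣ (solve 6 (λ U i y h c W → (U :- i :* (y :* h)) :- (U :+ c :* W :* h) := :- ((i :* y :+ c :* W) :* h))
                        refl U (fromℕ m) (x m) (½^ m) (periodFactor T) (window m)) ⟩
        ∣ - error m ∣
          ≡⟨ trans (ℚ.∣-p∣≡∣p∣ (error m)) (ℚ.0≤p⇒∣p∣≡p (error-nonNeg m)) ⟩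
        error m
          ≤⟨ ℚ.*-monoʳ-≤-nonNeg (½^ m) {{nonNegative (½^-nonNeg m)}} (ℚ.+-mono-≤
               (ℚ.*-monoˡ-≤-nonNeg (fromℕ m) {{nonNegative (fromℕ-nonNeg m)}} (x≤b m))
               (ℚ.≤-trans (ℚ.*-monoʳ-≤-nonNeg (window m) {{nonNegative (window-nonNeg m)}} (periodFactor≤2 0<T))
                          (ℚ.*-monoˡ-≤-nonNeg (fromℕ 2) {{nonNegative (fromℕ-nonNeg 2)}} (window≤ m)))) ⟩
        (fromℕ m * fromℕ b + fromℕ 2 * (fromℕ T * fromℕ b)) * ½^ m
          ≡⟨ cong (_* ½^ m) (cong₂ _+_ (fromℕ-* m b) (trans (fromℕ-* 2 (T ℕ.* b)) (cong (fromℕ 2 *_) (fromℕ-* T b)))) ⟨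
        (fromℕ (m ℕ.* b) + fromℕ (2 ℕ.* (T ℕ.* b))) * ½^ m
          ≡⟨ cong (_* ½^ m) (fromℕ-+ (m ℕ.* b) (2 ℕ.* (T ℕ.* b))) ⟨
        fromℕ (m ℕ.* b ℕ.+ 2 ℕ.* (T ℕ.* b)) * ½^ m
          ∎
        where
        open ℚ.≤-Reasoning
        U = sumℚ m term

  fromℕ*½^<ε : ∀ {a m d b ε} → ε * fromℕ (suc d) ≡ fromℕ (suc b) → a ℕ.* suc d ℕ.< 2 ^ m → fromℕ a * ½^ m < ε
  fromℕ*½^<ε {a} {m} {d} {b} {ε} ε[1+d]≡1+b a[1+d]<2^m =
    ℚ.*-cancelʳ-<-nonNeg (D * P) {{nonNegative (*-nonNeg (fromℕ-nonNeg (suc d)) (fromℕ-nonNeg (2 ^ m)))}} (begin-strict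
      fromℕ a * ½^ m * (D * P)   ≡⟨ solve 4 (λ a h d p → a :* h :* (d :* p) := a :* d :* (h :* p)) refl (fromℕ a) (½^ m) D P ⟩
      fromℕ a * D * (½^ m * P)   ≡⟨ cong₂ _*_ (fromℕ-* a (suc d)) (sym (½^-*-2^ m)) ⟨
      fromℕ (a ℕ.* suc d) * 1ℚ   ≡⟨ ℚ.*-identityʳ _ ⟩
      fromℕ (a ℕ.* suc d)        <⟨ fromℕ-mono-< a[1+d]<2^m ⟩
      P                          ≡⟨ ℚ.*-identityˡ P ⟨
      1ℚ * P                     ≤⟨ ℚ.*-monoʳ-≤-nonNeg P {{nonNegative (fromℕ-nonNeg (2 ^ m))}} (fromℕ-mono-≤ {1} {suc b} (ℕ.s≤s ℕ.z≤n)) ⟩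
      fromℕ (suc b) * P          ≡⟨ cong (_* P) ε[1+d]≡1+b ⟨
      ε * D * P                  ≡⟨ ℚ.*-assoc ε D P ⟩
      ε * (D * P)                ∎)
    where
    open ℚ.≤-Reasoning
    D = fromℕ (suc d)
    P = fromℕ (2 ^ m)

  converges-if-error≤linear*½^ : ∀ (a : ℕ → ℚ) L A B →
    (∀ m → ∣ a (suc m) - L ∣ ≤ fromℕ (m ℕ.* A ℕ.+ B) * ½^ m) → ConvergesTo a L
  converges-if-error≤linear*½^ a L A B error≤ ε 0<ε with positive⇒fraction ε 0<ε
  ... | d , b , ε[1+d]≡1+b = suc (4 ℕ.+ C) , λ where
      zero    ()
      (suc m) (ℕ.s≤s 4+C≤m) → ℚ.≤-<-trans (error≤ m)
        (fromℕ*½^<ε {m ℕ.* A ℕ.+ B} {m} {d} {b} ε[1+d]≡1+b (ℕ.≤-<-trans (bound m 4+C≤m) (m*C<2^m 4+C≤m)))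
    where
    C = (A ℕ.+ B) ℕ.* suc d
    bound : ∀ m → 4 ℕ.+ C ℕ.≤ m → (m ℕ.* A ℕ.+ B) ℕ.* suc d ℕ.≤ m ℕ.* C
    bound m 4+C≤m = ℕ.≤-trans (ℕ.*-monoˡ-≤ (suc d) (ℕ.≤-trans
        (ℕ.+-monoʳ-≤ (m ℕ.* A) (ℕ.m≤n*m B m))
        (ℕ.≤-reflexive (sym (ℕ.*-distribˡ-+ m A B)))))
      (ℕ.≤-reflexive (ℕ.*-assoc m (A ℕ.+ B) (suc d)))
      where
      instance
        _ : ℕ.NonZero m
        _ = ℕ.>-nonZero (ℕ.≤-trans (ℕ.s≤s ℕ.z≤n) 4+C≤m)

  survivalProb : ℕ → ℕ → ℚ
  survivalProb n t = fromℕ (undec n t) * ½^ t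

  stopProb-suc : ∀ n t → stopProb n (suc t) ≡ survivalProb n t - survivalProb n (suc t)
  stopProb-suc n t = begin
    stopProb n (suc t)
      ≡⟨ divℕ≡fromℕ*divℕ1 (2 ℕ.* r ℕ.∸ r′) (ℕ.m^n>0 2 (suc t)) ⟩
    fromℕ (2 ℕ.* r ℕ.∸ r′) * ½^ (suc t)
      ≡⟨ cong (_* ½^ (suc t)) (trans (fromℕ-∸ (undec≤avail n (suc t))) (cong (_- fromℕ r′) (fromℕ-* 2 r))) ⟩
    (fromℕ 2 * fromℕ r - fromℕ r′) * ½^ (suc t)
      ≡⟨ solve 4 (λ two x y h → (two :* x :- y) :* h := x :* (h :* two) :- y :* h) refl (fromℕ 2) (fromℕ r) (fromℕ r′) (½^ (suc t)) ⟩
    fromℕ r * (½^ (suc t) * fromℕ 2) - survivalProb n (suc t)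
      ≡⟨ cong (λ h → fromℕ r * h - survivalProb n (suc t)) (½^-suc t) ⟩
    survivalProb n t - survivalProb n (suc t)
      ∎
    where
    open ≡-Reasoning
    r = undec n t
    r′ = undec n (suc t)

  module _ (n : ℕ) .{{_ : ℕ.NonZero n}} {T : ℕ} (0<T : 0 ℕ.< T) (2^T≡1 : 2 ^ T ℕ.% n ≡ 1 ℕ.% n) where

    open PeriodicSeries (λ t → fromℕ (undec n t)) 0<T (λ t → cong fromℕ (undec-periodic n 2^T≡1 t))

    partialExp-error-≤ : ∀ m → ∣ partialExp n (suc m) - periodFactor T * window 0 ∣
                                 ≤ fromℕ (m ℕ.* n ℕ.+ 2 ℕ.* (T ℕ.* n)) * ½^ m
    partialExp-error-≤ m =
      subst (λ s → ∣ s - periodFactor T * window 0 ∣ ≤ fromℕ (m ℕ.* n ℕ.+ 2 ℕ.* (T ℕ.* n)) * ½^ m)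
            (sym (abel-summation (stopProb n) (survivalProb n) (stopProb-suc n) m))
            (abel-error-≤ (λ t → fromℕ-nonNeg (undec n t)) (λ t → fromℕ-mono-≤ (ℕ.<⇒≤ (undec<n n t))) m)

    partialExp-converges : ConvergesTo (partialExp n) (periodFactor T * window 0)
    partialExp-converges = converges-if-error≤linear*½^ (partialExp n) _ n (2 ℕ.* (T ℕ.* n)) partialExp-error-≤

    window0≡ : window 0 ≡ sumℚ T (λ i → divℕ (2 ^ i ℕ.% n) (2 ^ i))
    window0≡ = sumℚ-cong T (λ i → trans (cong (λ r → fromℕ r * ½^ i) (undec≡2^%n n i))
                                        (sym (divℕ≡fromℕ*divℕ1 (2 ^ i ℕ.% n) (ℕ.m^n>0 2 i))))

    expectedTosses : ExpectedTosses n (periodFactor T * sumℚ T (λ i → divℕ (2 ^ i ℕ.% n) (2 ^ i)))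
    expectedTosses = subst (λ s → ExpectedTosses n (periodFactor T * s)) window0≡ partialExp-converges

open import Data.Nat using (ℕ; _*_; _^_; _∸_; _%_; _<_; NonZero)
open import Data.Nat.Divisibility using (_∣_)
open import Data.Rational using (ℚ) renaming (_*_ to _*ℚ_)
open import Relation.Nullary using (¬_)
open import Data.Product using (_,_)
open import Data.Nat.Properties using (*-mono-≤)

proposition3 : (n : ℕ) → .{{_ : NonZero n}} → ¬ (2 ∣ n) → (d : ℕ) → IsOrderOf2 n d
    → (k : ℕ) → 0 < k
    → ExpectedTosses n
        (divℕ (2 ^ (k * d)) (2 ^ (k * d) ∸ 1)
          *ℚ sumℚ (k * d) (λ i → divℕ (2 ^ i % n) (2 ^ i)))
proposition3 n _ d (0<d , 2^d≡1 , _) k 0<k = expectedTosses n (*-mono-≤ 0<k 0<d) (2^[k*d]%n≡1 n 2^d≡1 k)
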